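{- Let $w$ be a word and let $(a_i)$ be a representing sequence. The following are equivalent: (1) $w$ is the representation word of $(a_i)$; (2) $w$ is infinite, and for each nonnegative integer $n$, \[ w[n]=\begin{cases} n & n<a_1,\\ a_1 & n=a_{j+1}-1\text{ and }j\geq1,\\ w[n-a_j] & \text{otherwise},\end{cases} \] where $j$ is the index of $n$, i.e. the integer with $a_j\le n<a_{j+1}$.
   Context: A representing sequence is a strictly increasing sequence $(a_i)_{i\ge0}$ of positive integers with $a_0=1$. For $n\ge1$ with $a_j\le n<a_{j+1}$, the $(a_i)$-representation of $n$ is the digit string $d_j\cdots d_0$ with $n=\sum d_ia_i$ and $\sum d_i$ minimal (greedy: $d_j=\lfloor n/a_j\rfloor$, then recursively $n\bmod a_j$); the representation of $0$ is the digit $0$. $n\ge0$ is $2$-volatile if the representation of $n+1$ ends in at least two zeros. The representation word of $(a_i)$ is the infinite word $w$ over $\{0,\dots,a_1\}$ (indexed from $0$) with $w[n]=a_1$ if $n$ is $2$-volatile and otherwise $w[n]$ equals the last digit of the representation of $n$. -}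

module Defs where

open import Data.Nat using (ℕ; zero; suc; _≤_; _<_; _<ᵇ_)
open import Data.Nat.DivMod using (_%_; _/_)
open import Data.Bool using (if_then_else_)
open import Data.List using (List)
open import Data.Sum using (_⊎_; inj₂)
open import Data.Product using (Σ; _×_)
open import Relation.Binary.PropositionalEquality using (_≡_; _≢_)
open import Relation.Nullary using (¬_)

IsRepresentingSequence : (ℕ → ℕ) → Set
IsRepresentingSequence a = (a 0 ≡ 1) × (∀ i → a i < a (suc i))

-- mod / div totalised at 0 (never used at 0 for a representing sequence,
-- whose terms are all ≥ 1).
_%'_ : ℕ → ℕ → ℕ
m %' zero    = m
m %' suc k   = m % suc k

_/'_ : ℕ → ℕ → ℕ
m /' zero    = zero
m /' suc k   = m / suc k

red : (ℕ → ℕ) → ℕ → ℕ → ℕ → ℕ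
red a zero    i m = m
red a (suc t) i m = if i <ᵇ suc t then red a t i (m %' a (suc t)) else m

-- Starting the greedy algorithm at position n is harmless: the index j of n
-- satisfies j < n (as a_j ≥ j+1), and for positions p > j we have n < a_p,
-- so reducing mod a_p does nothing (and the digit there is 0).
digit : (ℕ → ℕ) → ℕ → ℕ → ℕ
digit a i n = red a n i n /' a i

-- Last digit of the representation of n (for n = 0 this gives 0, matching
-- the convention that 0 is represented by the digit 0).
lastDigit : (ℕ → ℕ) → ℕ → ℕ
lastDigit a n = digit a 0 n

-- n is 2-volatile: the representation of n+1 has at least two digits
-- (index of n+1 is ≥ 1, i.e. a_1 ≤ n+1) and its last two digits are 0.
Volatile2 : (ℕ → ℕ) → ℕ → Set
Volatile2 a n = (a 1 ≤ suc n) × (digit a 0 (suc n) ≡ 0) × (digit a 1 (suc n) ≡ 0)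

Word : Set
Word = List ℕ ⊎ (ℕ → ℕ)

IsRepresentationWord : (ℕ → ℕ) → Word → Set
IsRepresentationWord a w =
  Σ (ℕ → ℕ) λ f → (w ≡ inj₂ f) ×
    (∀ n → (Volatile2 a n → f n ≡ a 1) × (¬ Volatile2 a n → f n ≡ lastDigit a n))

SatisfiesRecurrence : (ℕ → ℕ) → Word → Set
SatisfiesRecurrence a w =
  Σ (ℕ → ℕ) λ f → (w ≡ inj₂ f) ×
    (∀ n → (n < a 1 → f n ≡ n) ×
      (∀ j → 1 ≤ j → a j ≤ n → n < a (suc j) →
        (suc n ≡ a (suc j) → f n ≡ a 1) ×
        (suc n ≢ a (suc j) → f n ≡ f (n Data.Nat.∸ a j))))

-- If a_j ≤ m < a_(j+1), the greedy algorithm starts by reducing m modulo a_j, and m ≡ m − a_j there,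
-- so all digits below position j of m and of m − a_j agree.
-- Hence, outside the last slot a_(j+1) − 1 of a block (where n + 1 = a_(j+1) ends in zeros and n is
-- 2-volatile), both the last digit and the volatility of n are those of n − a_j; below a_1 the word
-- is the identity.  This shows that the representation word satisfies the recurrence, and the
-- recurrence determines a stream by well-founded recursion, since n − a_j < n.
module Submission where

open import Defs
open import Data.Nat using (ℕ; zero; suc; _+_; _∸_; _≤_; _<_; _<ᵇ_; z≤n; s≤s; _≤?_; _<?_; _≟_)
open import Data.Nat.Properties
open import Data.Nat.DivMod using (m<n⇒m%n≡m; [m+n]%n≡m%n; n%n≡0; n/1≡n; m≥n⇒m/n>0)
open import Data.Nat.Induction using (<-wellFounded)
open import Induction.WellFounded using (Acc; acc)
open import Data.Bool using (true; false)
open import Data.Unit using (tt)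
open import Data.Empty using (⊥-elim)
open import Data.Sum using (inj₁; inj₂)
open import Data.Product using (Σ; _×_; _,_; proj₁; proj₂)
open import Function.Base using (_∘_)
open import Function.Bundles using (_⇔_; mk⇔; Equivalence)
open import Relation.Binary.PropositionalEquality
open import Relation.Nullary using (¬_; Dec; yes; no)
open import Relation.Nullary.Decidable using (_×-dec_)

m<n⇒m%'n≡m : ∀ {m n} → m < n → m %' n ≡ m
m<n⇒m%'n≡m {n = suc _} = m<n⇒m%n≡m

[m+n]%'n≡m%'n : ∀ m n → (m + n) %' n ≡ m %' n
[m+n]%'n≡m%'n m zero    = +-identityʳ m
[m+n]%'n≡m%'n m (suc n) = [m+n]%n≡m%n m (suc n)

n%'n≡0 : ∀ n → n %' n ≡ 0
n%'n≡0 zero    = refl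
n%'n≡0 (suc n) = n%n≡0 (suc n)

0%'n≡0 : ∀ n → 0 %' n ≡ 0
0%'n≡0 zero    = refl
0%'n≡0 (suc n) = refl

0/'n≡0 : ∀ n → 0 /' n ≡ 0
0/'n≡0 zero    = refl
0/'n≡0 (suc n) = refl

m≥n⇒m/'n>0 : ∀ {m n} → 0 < n → n ≤ m → 0 < m /' n
m≥n⇒m/'n>0 {n = suc _} _ = m≥n⇒m/n>0

red-suc-< : ∀ a {t i} m → i < suc t → red a (suc t) i m ≡ red a t i (m %' a (suc t))
red-suc-< a {t} {i} m i<1+t with i <ᵇ suc t | <⇒<ᵇ i<1+t
... | true | _ = refl

red-suc-≮ : ∀ a {t i} m → ¬ i < suc t → red a (suc t) i m ≡ m
red-suc-≮ a {t} {i} m i≮1+t with i <ᵇ suc t | <ᵇ⇒< i (suc t)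
... | true  | i<1+t = ⊥-elim (i≮1+t (i<1+t tt))
... | false | _     = refl

red-≤ : ∀ a {t i} m → t ≤ i → red a t i m ≡ m
red-≤ a {zero}  m _   = refl
red-≤ a {suc t} m t<i = red-suc-≮ a m (≤⇒≯ t<i)

red-0 : ∀ a t i → red a t i 0 ≡ 0
red-0 a zero    i = refl
red-0 a (suc t) i with i <? suc t
... | no  i≮1+t = red-suc-≮ a 0 i≮1+t
... | yes i<1+t = begin
  red a (suc t) i 0            ≡⟨ red-suc-< a 0 i<1+t ⟩
  red a t i (0 %' a (suc t))   ≡⟨ cong (red a t i) (0%'n≡0 (a (suc t))) ⟩
  red a t i 0                  ≡⟨ red-0 a t i ⟩
  0                            ∎
  where open ≡-Reasoning

module RepresentingSequence (a : ℕ → ℕ) (isRep : IsRepresentingSequence a) where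

  a0≡1 : a 0 ≡ 1
  a0≡1 = proj₁ isRep

  a-< : ∀ i → a i < a (suc i)
  a-< = proj₂ isRep

  a-mono : ∀ {i k} → i ≤ k → a i ≤ a k
  a-mono {k = zero} z≤n = ≤-refl
  a-mono {k = suc k} i≤1+k with m≤n⇒m<n∨m≡n i≤1+k
  ... | inj₁ i<1+k = ≤-trans (a-mono (≤-pred i<1+k)) (<⇒≤ (a-< k))
  ... | inj₂ refl  = ≤-refl

  n<a[n] : ∀ n → n < a n
  n<a[n] zero    = ≤-reflexive (sym a0≡1)
  n<a[n] (suc n) = ≤-<-trans (n<a[n] n) (a-< n)

  a-pos : ∀ i → 0 < a i
  a-pos i = ≤-<-trans z≤n (n<a[n] i)

  red-suc-inert : ∀ {t i m} → m < a (suc t) → red a (suc t) i m ≡ red a t i m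
  red-suc-inert {t} {i} {m} m<a with i <? suc t
  ... | yes i<1+t = trans (red-suc-< a m i<1+t) (cong (red a t i) (m<n⇒m%'n≡m m<a))
  ... | no  i≮1+t = trans (red-suc-≮ a m i≮1+t) (sym (red-≤ a {t} m (<⇒≤ (≮⇒≥ i≮1+t))))

  red-stable : ∀ {t i m} s → m < a (suc t) → t ≤ s → red a s i m ≡ red a t i m
  red-stable zero    _   z≤n = refl
  red-stable (suc s) m<a t≤1+s with m≤n⇒m<n∨m≡n t≤1+s
  ... | inj₂ refl  = refl
  ... | inj₁ t<1+s = trans (red-suc-inert (<-≤-trans m<a (a-mono t<1+s)))
                           (red-stable s m<a (≤-pred t<1+s))

  reduce : ℕ → ℕ → ℕ
  reduce i m = red a m i m

  red≡reduce : ∀ {t i m} → m < a (suc t) → red a t i m ≡ reduce i m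
  red≡reduce {t} {i} {m} m<a with ≤-total t m
  ... | inj₁ t≤m = sym (red-stable m m<a t≤m)
  ... | inj₂ m≤t = red-stable t (<-trans (n<a[n] m) (a-< m)) m≤t

  reduce-small : ∀ {i m} → m < a (suc i) → reduce i m ≡ m
  reduce-small {i} {m} m<a = trans (sym (red≡reduce m<a)) (red-≤ a {i} m ≤-refl)

  reduce-∸ : ∀ {i j m} → i < j → a j ≤ m → m < a (suc j) → reduce i m ≡ reduce i (m ∸ a j)
  reduce-∸ {i} {suc j} {m} i<j a≤m m<a = begin
    reduce i m                                 ≡⟨ red≡reduce m<a ⟨
    red a (suc j) i m                          ≡⟨ red-suc-< a m i<j ⟩
    red a j i (m %' a (suc j))                 ≡⟨ cong (λ k → red a j i (k %' a (suc j))) (m∸n+n≡m a≤m) ⟨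
    red a j i ((m ∸ a (suc j) + a (suc j)) %' a (suc j))
                                               ≡⟨ cong (red a j i) ([m+n]%'n≡m%'n (m ∸ a (suc j)) (a (suc j))) ⟩
    red a j i ((m ∸ a (suc j)) %' a (suc j))   ≡⟨ red-suc-< a (m ∸ a (suc j)) i<j ⟨
    red a (suc j) i (m ∸ a (suc j))            ≡⟨ red≡reduce (≤-<-trans (m∸n≤m m (a (suc j))) m<a) ⟩
    reduce i (m ∸ a (suc j))                   ∎
    where open ≡-Reasoning

  reduce-a : ∀ {i j} → i ≤ j → reduce i (a (suc j)) ≡ 0
  reduce-a {i} {j} i≤j = begin
    reduce i (a (suc j))                       ≡⟨ red≡reduce (a-< (suc j)) ⟨
    red a (suc j) i (a (suc j))                ≡⟨ red-suc-< a (a (suc j)) (s≤s i≤j) ⟩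
    red a j i (a (suc j) %' a (suc j))         ≡⟨ cong (red a j i) (n%'n≡0 (a (suc j))) ⟩
    red a j i 0                                ≡⟨ red-0 a j i ⟩
    0                                          ∎
    where open ≡-Reasoning

  digit-0≡reduce : ∀ m → digit a 0 m ≡ reduce 0 m
  digit-0≡reduce m rewrite a0≡1 = n/1≡n (reduce 0 m)

  digit-∸ : ∀ {i j m} → i < j → a j ≤ m → m < a (suc j) → digit a i m ≡ digit a i (m ∸ a j)
  digit-∸ i<j a≤m m<a = cong (_/' a _) (reduce-∸ i<j a≤m m<a)

  digit-0-small : ∀ {m} → m < a 1 → digit a 0 m ≡ m
  digit-0-small {m} m<a = trans (digit-0≡reduce m) (reduce-small m<a)

  digit-1-pos : ∀ {m} → a 1 ≤ m → m < a 2 → 0 < digit a 1 m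
  digit-1-pos a≤m m<a rewrite reduce-small m<a = m≥n⇒m/'n>0 (a-pos 1) a≤m

  index : ∀ {n} → a 1 ≤ n → Σ ℕ λ j → 1 ≤ j × a j ≤ n × n < a (suc j)
  index {n} a≤n = search 1 n ≤-refl a≤n (≤-trans (n<a[n] n) (a-mono (m≤m+n n 1)))
    where
    search : ∀ k fuel → 1 ≤ k → a k ≤ n → n < a (fuel + k) → Σ ℕ λ j → 1 ≤ j × a j ≤ n × n < a (suc j)
    search k zero    _   a≤n n<a = ⊥-elim (<-irrefl refl (≤-<-trans a≤n n<a))
    search k (suc f) 1≤k a≤n n<a with n <? a (suc k)
    ... | yes n<a′ = k , 1≤k , a≤n , n<a′
    ... | no  n≮a′ = search (suc k) f (m≤n⇒m≤1+n 1≤k) (≮⇒≥ n≮a′) (subst (λ x → n < a x) (sym (+-suc f k)) n<a)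

  volatile? : ∀ n → Dec (Volatile2 a n)
  volatile? n = (a 1 ≤? suc n) ×-dec ((digit a 0 (suc n) ≟ 0) ×-dec (digit a 1 (suc n) ≟ 0))

  ¬volatile-below-a2 : ∀ {n} → suc n < a 2 → ¬ Volatile2 a n
  ¬volatile-below-a2 n<a (a≤n , _ , d1≡0) = <-irrefl (sym d1≡0) (digit-1-pos a≤n n<a)

  volatile-block-end : ∀ {n j} → 1 ≤ j → suc n ≡ a (suc j) → Volatile2 a n
  volatile-block-end {n} {j} 1≤j 1+n≡a =
    subst (λ m → a 1 ≤ m × digit a 0 m ≡ 0 × digit a 1 m ≡ 0) (sym 1+n≡a)
      ( a-mono (s≤s z≤n)
      , trans (digit-0≡reduce (a (suc j))) (reduce-a {0} {j} z≤n)
      , trans (cong (_/' a 1) (reduce-a {1} {j} 1≤j)) (0/'n≡0 (a 1)) )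

  -- For j = 1 neither side is volatile; for j ≥ 2 the two last digits of n + 1 are those of n + 1 − a_j.
  volatile-∸ : ∀ {n j} → 1 ≤ j → a j ≤ n → suc n < a (suc j) → Volatile2 a n ⇔ Volatile2 a (n ∸ a j)
  volatile-∸ {n} {j} 1≤j a≤n 1+n<a with 2 ≤? j
  ... | no  j≱2 rewrite ≤-antisym (≤-pred (≰⇒> j≱2)) 1≤j =
    mk⇔ (⊥-elim ∘ ¬volatile-below-a2 1+n<a)
        (⊥-elim ∘ ¬volatile-below-a2 (≤-<-trans (s≤s (m∸n≤m n (a 1))) 1+n<a))
  ... | yes j≥2 = mk⇔ to from
    where
    digit-∸′ : ∀ {i} → i < j → digit a i (suc n) ≡ digit a i (suc (n ∸ a j))
    digit-∸′ i<j = trans (digit-∸ i<j (m≤n⇒m≤1+n a≤n) 1+n<a) (cong (digit a _) (+-∸-assoc 1 a≤n))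

    to : Volatile2 a n → Volatile2 a (n ∸ a j)
    to (_ , d0≡0 , d1≡0) = a≤1+n′ , d0′≡0 , trans (sym (digit-∸′ j≥2)) d1≡0
      where
      d0′≡0 : digit a 0 (suc (n ∸ a j)) ≡ 0
      d0′≡0 = trans (sym (digit-∸′ 1≤j)) d0≡0
      a≤1+n′ : a 1 ≤ suc (n ∸ a j)
      a≤1+n′ with a 1 ≤? suc (n ∸ a j)
      ... | yes a≤ = a≤
      ... | no  a≰ = ⊥-elim (1+n≢0 (trans (sym (digit-0-small (≰⇒> a≰))) d0′≡0))

    from : Volatile2 a (n ∸ a j) → Volatile2 a n
    from (_ , d0≡0 , d1≡0) =
      ≤-trans (a-mono 1≤j) (m≤n⇒m≤1+n a≤n) , trans (digit-∸′ 1≤j) d0≡0 , trans (digit-∸′ j≥2) d1≡0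

  IsRepresentationStream : (ℕ → ℕ) → Set
  IsRepresentationStream f = ∀ n → (Volatile2 a n → f n ≡ a 1) × (¬ Volatile2 a n → f n ≡ lastDigit a n)

  SatisfiesRecurrenceStream : (ℕ → ℕ) → Set
  SatisfiesRecurrenceStream f = ∀ n → (n < a 1 → f n ≡ n) ×
    (∀ j → 1 ≤ j → a j ≤ n → n < a (suc j) →
      (suc n ≡ a (suc j) → f n ≡ a 1) × (suc n ≢ a (suc j) → f n ≡ f (n ∸ a j)))

  representation-cong : ∀ {f m n} → IsRepresentationStream f →
    Volatile2 a m ⇔ Volatile2 a n → lastDigit a m ≡ lastDigit a n → f m ≡ f n
  representation-cong {f} {m} {n} rep v⇔ last≡ with volatile? m
  ... | yes v = trans (proj₁ (rep m) v) (sym (proj₁ (rep n) (Equivalence.to v⇔ v)))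
  ... | no ¬v = trans (proj₂ (rep m) ¬v)
                      (trans last≡ (sym (proj₂ (rep n) (¬v ∘ Equivalence.from v⇔))))

  representation-recurs : ∀ {f} → IsRepresentationStream f → SatisfiesRecurrenceStream f
  representation-recurs {f} rep n = below-a1 , inside-block
    where
    below-a1 : n < a 1 → f n ≡ n
    below-a1 n<a = trans (proj₂ (rep n) (¬volatile-below-a2 (<-≤-trans (s≤s n<a) (a-< 1))))
                         (digit-0-small n<a)
    inside-block : ∀ j → 1 ≤ j → a j ≤ n → n < a (suc j) →
      (suc n ≡ a (suc j) → f n ≡ a 1) × (suc n ≢ a (suc j) → f n ≡ f (n ∸ a j))
    inside-block j 1≤j a≤n n<a =
      (λ end → proj₁ (rep n) (volatile-block-end 1≤j end)) ,
      (λ ¬end → representation-cong rep (volatile-∸ 1≤j a≤n (≤∧≢⇒< n<a ¬end))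
                                        (digit-∸ 1≤j a≤n n<a))

  recurrence-unique : ∀ {f g} → SatisfiesRecurrenceStream f → SatisfiesRecurrenceStream g → ∀ n → f n ≡ g n
  recurrence-unique {f} {g} rec-f rec-g n = go n (<-wellFounded n)
    where
    go : ∀ n → Acc _<_ n → f n ≡ g n
    go n (acc rec) with n <? a 1
    ... | yes n<a = trans (proj₁ (rec-f n) n<a) (sym (proj₁ (rec-g n) n<a))
    ... | no  n≮a with index (≮⇒≥ n≮a)
    ... | j , 1≤j , a≤n , n<a with suc n ≟ a (suc j)
    ...   | yes end = trans (proj₁ (proj₂ (rec-f n) j 1≤j a≤n n<a) end)
                            (sym (proj₁ (proj₂ (rec-g n) j 1≤j a≤n n<a) end))
    ...   | no ¬end = trans (proj₂ (proj₂ (rec-f n) j 1≤j a≤n n<a) ¬end)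
                            (trans (go (n ∸ a j) (rec (∸-monoʳ-< (a-pos j) a≤n)))
                                   (sym (proj₂ (proj₂ (rec-g n) j 1≤j a≤n n<a) ¬end)))

  representationStream : ℕ → ℕ
  representationStream n with volatile? n
  ... | yes _ = a 1
  ... | no  _ = lastDigit a n

  representationStream-isRepresentation : IsRepresentationStream representationStream
  representationStream-isRepresentation n with volatile? n
  ... | yes v = (λ _ → refl) , (λ ¬v → ⊥-elim (¬v v))
  ... | no ¬v = (λ v → ⊥-elim (¬v v)) , (λ _ → refl)

  recurrence⇒representation : ∀ {f} → SatisfiesRecurrenceStream f → IsRepresentationStream f
  recurrence⇒representation {f} rec n =
    (λ v → trans (f≡rep n) (proj₁ (rep n) v)) , (λ ¬v → trans (f≡rep n) (proj₂ (rep n) ¬v))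
    where
    rep = representationStream-isRepresentation
    f≡rep : ∀ n → f n ≡ representationStream n
    f≡rep = recurrence-unique rec (representation-recurs rep)

theorem4p3 : (a : ℕ → ℕ) → IsRepresentingSequence a → (w : Word) →
    IsRepresentationWord a w ⇔ SatisfiesRecurrence a w
theorem4p3 a isRep w = mk⇔
  (λ (f , w≡f , rep) → f , w≡f , representation-recurs rep)
  (λ (f , w≡f , rec) → f , w≡f , recurrence⇒representation rec)
  where open RepresentingSequence a isRep
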